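{- For all integers $n\geq2$, \[ H_{2n-3}=(-1)^n\sum_{j=2}^nLS(n,j)\,j!\,s(j,2)-\delta_{n,2}, \] where $H_{2k-1}$ are the median Genocchi numbers, $LS(n,j)$ are the Legendre–Stirling numbers of the second kind, and $s(j,2)$ are classical (signed) Stirling numbers of the first kind.
   Context: Seidel triangle: numbers $g_{n,j}$ for $j\geq1$, $1\leq n\leq (j+1)/2$ (zero outside this range), with $g_{1,1}=1$, $g_{n,2j}=\sum_{q\geq n}g_{q,2j-1}$, $g_{n,2j+1}=\sum_{q\leq n}g_{q,2j}$; the median Genocchi numbers are $H_{2k-1}=g_{1,2k}$. $LS(n,j)$ is defined by $LS(n+1,j)=LS(n,j-1)+j(j+1)LS(n,j)$, $LS(n,0)=\delta_{n,0}$, $LS(n,j)=0$ for $n<j$. The signed Stirling numbers of the first kind are defined by $z(z+1)\cdots(z+n-1)=\sum_{j=0}^n(-1)^{n+j}s(n,j)z^j$. -}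

module Defs where

open import Data.Nat as ℕ using (ℕ; zero; suc; _≤ᵇ_; _/_; _!)
open import Data.Bool using (Bool; true; false; not; if_then_else_; _∧_)
open import Data.Integer as ℤ using (ℤ; +_; -_)

sumFromTo : ℕ → ℕ → (ℕ → ℕ) → ℕ
sumFromTo a zero f = if a ≤ᵇ 0 then f 0 else 0
sumFromTo a (suc b) f = (if a ≤ᵇ suc b then f (suc b) else 0) ℕ.+ sumFromTo a b f

-- Seidel triangle g n j, with support 1 ≤ n ≤ (j+1)/2, j ≥ 1 (zero outside).
-- g 1 1 = 1;  g n (2j) = Σ_{q ≥ n} g q (2j-1);  g n (2j+1) = Σ_{q ≤ n} g q (2j).
-- (Column j only has support q ≤ (j+1)/2, so the infinite sums are finite.)
isEven : ℕ → Bool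
isEven zero = true
isEven (suc n) = not (isEven n)

restrict : ℕ → (ℕ → ℕ) → ℕ → ℕ
restrict j f n = if (1 ≤ᵇ n) ∧ (n ≤ᵇ (suc j / 2)) then f n else 0

column : ℕ → ℕ → ℕ
column zero n = 0
column (suc zero) n = restrict 1 (λ _ → 1) n
column (suc (suc j)) n =
  restrict (suc (suc j))
    (λ m → if isEven (suc (suc j))
      -- g n (2i) = Σ_{q ≥ n} g q (2i-1); column 2i-1 vanishes for q > i
      then sumFromTo m (suc (suc j)) (column (suc j))
      else sumFromTo 1 m (column (suc j)))
    n

seidel : ℕ → ℕ → ℕ
seidel n j = column j n

-- Median Genocchi numbers: H (2k-1) = g 1 (2k); indexed here by k.
-- medianGenocchi k = H_{2k-1}
medianGenocchi : ℕ → ℕ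
medianGenocchi k = seidel 1 (2 ℕ.* k)

LS : ℕ → ℕ → ℕ
LS zero zero = 1
LS zero (suc j) = 0
LS (suc n) zero = 0
LS (suc n) (suc j) = LS n j ℕ.+ (suc j ℕ.* suc (suc j)) ℕ.* LS n (suc j)

stirling1u : ℕ → ℕ → ℕ
stirling1u zero zero = 1
stirling1u zero (suc j) = 0
stirling1u (suc n) zero = 0
stirling1u (suc n) (suc j) = stirling1u n j ℕ.+ n ℕ.* stirling1u n (suc j)

sgn : ℕ → ℤ
sgn zero = ℤ.+ 1
sgn (suc m) = ℤ.- sgn m

stirling1 : ℕ → ℕ → ℤ
stirling1 n j = sgn (n ℕ.+ j) ℤ.* (+ stirling1u n j)

sumℤ : ℕ → ℕ → (ℕ → ℤ) → ℤ
sumℤ a zero f = if a ≤ᵇ 0 then f 0 else + 0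
sumℤ a (suc b) f = (if a ≤ᵇ suc b then f (suc b) else + 0) ℤ.+ sumℤ a b f

δ : ℕ → ℕ → ℤ
δ m n = if m ℕ.≡ᵇ n then + 1 else + 0

module Submission where

-- Write D_c f(x) = x(x+c)(f(x+1) − f(x)) for c = 0, 1. The even columns of the Seidel
-- triangle have the closed form g(a+1, 2(a+b+1)) = (D₁ᵇ D₀ᵃ id)(1): the odd column in
-- between is a difference of the next even column, and the recurrence linking two even
-- columns becomes the operator identity (D₁ − D₀)D₀ − D₁(D₁ − D₀) = D₀. Hence
-- H_{2k+1} = (D₁ᵏ id)(1).
-- On the other side Σⱼ LS(n,j) ψ(j) = (Λⁿ ψ)(0) with Λψ(j) = ψ(j+1) + j(j+1)ψ(j), and on
-- j ≥ 1 multiplication by the weight (−1)^(j+1) j! (j−1)! conjugates Λ into −D₁. Since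
-- Λ maps j! s(j,2) to the weight times j + 1, the Legendre–Stirling sum is ± (D₁ᵏ (id + 1))(1),
-- which differs from (D₁ᵏ id)(1) only for k = 0, because D₁ kills constants.

open import Defs
open import Data.Nat using (ℕ; _≤_; _∸_)
open import Data.Nat using (_!)
open import Data.Integer using (ℤ; +_; _*_; _-_)
open import Relation.Binary.PropositionalEquality using (_≡_)

open import Data.Bool using (true; false; if_then_else_; not)
open import Data.Bool.Properties using (not-involutive; T-≡)
open import Data.Integer using (-_; _+_)
import Data.Integer.Properties as ℤₚ
open import Algebra.Properties.CommutativeSemigroup ℤₚ.+-commutativeSemigroup
  using () renaming (interchange to +-interchange)
open import Data.Integer.Tactic.RingSolver using (solve-∀)
open import Data.Nat as ℕ using (zero; suc; _<_; _≤ᵇ_; _/_; z≤n; s≤s; _≤?_)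
import Data.Nat.Properties as ℕₚ
open import Data.Nat.DivMod using (m/n≡1+[m∸n]/n)
open import Data.Nat.GeneralisedArithmetic using (fold; iterate-is-fold)
open import Data.Sum using (inj₁; inj₂)
open import Function.Bundles using (Equivalence)
open import Relation.Binary.PropositionalEquality
  using (refl; sym; trans; cong; cong₂; cong-app; subst; module ≡-Reasoning)
open import Relation.Nullary using (yes; no; contradiction)
open import Relation.Nullary.Reflects using (ofʸ)

open ≡-Reasoning

≤ᵇ-true : ∀ {m n} → m ≤ n → (m ≤ᵇ n) ≡ true
≤ᵇ-true m≤n = Equivalence.to T-≡ (ℕₚ.≤⇒≤ᵇ m≤n)

≤ᵇ-false : ∀ {m n} → n < m → (m ≤ᵇ n) ≡ false
≤ᵇ-false {m} {n} n<m with m ≤ᵇ n | ℕₚ.≤ᵇ-reflects-≤ m n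
... | false | _ = refl
... | true | ofʸ m≤n = contradiction m≤n (ℕₚ.<⇒≱ n<m)

fold-sucʳ : ∀ {A : Set} (z : A) (s : A → A) n → fold (s z) s n ≡ fold z s (suc n)
fold-sucʳ z s n = trans (iterate-is-fold (s z) s n) (sym (iterate-is-fold z s (suc n)))

-- Difference operators on integer sequences

Fn : Set
Fn = ℕ → ℤ

Δ : Fn → Fn
Δ f x = f (suc x) - f x

D₀ D₁ : Fn → Fn
D₀ f x = (+ x * + x) * Δ f x
D₁ f x = (+ x * + suc x) * Δ f x

idℤ : Fn
idℤ x = + x

D₁idℤ-D₀idℤ≡idℤ : ∀ x → D₁ idℤ x - D₀ idℤ x ≡ + x
D₁idℤ-D₀idℤ≡idℤ x = ring (+ x)
  where
  ring : ∀ X → (X * (+ 1 + X)) * ((+ 1 + X) - X) - (X * X) * ((+ 1 + X) - X) ≡ X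
  ring = solve-∀

[D₁-D₀]D₀-D₁[D₁-D₀]≡D₀ : ∀ g x →
  (D₁ (D₀ g) x - D₀ (D₀ g) x) - (D₁ (D₁ g) x - D₁ (D₀ g) x) ≡ D₀ g x
[D₁-D₀]D₀-D₁[D₁-D₀]≡D₀ g x = ring (+ x) (g x) (g (suc x)) (g (suc (suc x)))
  where
  ring : ∀ X a b c →
    (((X * (+ 1 + X)) * (((+ 1 + X) * (+ 1 + X)) * (c - b) - (X * X) * (b - a)))
      - ((X * X) * (((+ 1 + X) * (+ 1 + X)) * (c - b) - (X * X) * (b - a))))
    - (((X * (+ 1 + X)) * (((+ 1 + X) * (+ 1 + (+ 1 + X))) * (c - b) - (X * (+ 1 + X)) * (b - a)))
      - ((X * (+ 1 + X)) * (((+ 1 + X) * (+ 1 + X)) * (c - b) - (X * X) * (b - a))))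
    ≡ (X * X) * (b - a)
  ring = solve-∀

fold-D₁-cong : ∀ n (u v : Fn) → (∀ x → u x ≡ v x) → ∀ x → fold u D₁ n x ≡ fold v D₁ n x
fold-D₁-cong zero u v u≡v x = u≡v x
fold-D₁-cong (suc n) u v u≡v x =
  cong₂ (λ p q → (+ x * + suc x) * (p - q)) (fold-D₁-cong n u v u≡v (suc x)) (fold-D₁-cong n u v u≡v x)

fold-D₁-difference : ∀ n (u v w : Fn) → (∀ x → u x - v x ≡ w x) →
  ∀ x → fold u D₁ n x - fold v D₁ n x ≡ fold w D₁ n x
fold-D₁-difference zero u v w u-v≡w x = u-v≡w x
fold-D₁-difference (suc n) u v w u-v≡w x = begin
  (X * Y) * (U (suc x) - U x) - (X * Y) * (V (suc x) - V x)
    ≡⟨ ring X Y (U x) (U (suc x)) (V x) (V (suc x)) ⟩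
  (X * Y) * ((U (suc x) - V (suc x)) - (U x - V x))
    ≡⟨ cong₂ (λ p q → (X * Y) * (p - q)) (fold-D₁-difference n u v w u-v≡w (suc x))
                                        (fold-D₁-difference n u v w u-v≡w x) ⟩
  (X * Y) * (fold w D₁ n (suc x) - fold w D₁ n x) ∎
  where
  X Y : ℤ
  X = + x
  Y = + suc x
  U V : Fn
  U = fold u D₁ n
  V = fold v D₁ n
  ring : ∀ X Y a b c d → (X * Y) * (b - a) - (X * Y) * (d - c) ≡ (X * Y) * ((b - d) - (a - c))
  ring = solve-∀

-- Closed form of the Seidel triangle

secondDifference : ℤ → ℤ → ℤ → ℤ
secondDifference u v w = (v - w) - (u - v)

secondDifference-cong : ∀ {u u′ v v′ w w′} → u ≡ u′ → v ≡ v′ → w ≡ w′ →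
  secondDifference u v w ≡ secondDifference u′ v′ w′
secondDifference-cong refl refl refl = refl

-- The entry of column 2(a+b+1) in row a+1.
evenEntry : ℕ → ℕ → ℤ
evenEntry a b = fold (fold idℤ D₀ a) D₁ b 1

evenEntry-recurrence : ∀ a b →
  secondDifference (evenEntry a (suc (suc b))) (evenEntry (suc a) (suc b)) (evenEntry (suc (suc a)) b)
  ≡ evenEntry (suc a) b
evenEntry-recurrence a b = begin
  (fold (D₀ g) D₁ (suc b) 1 - fold (D₀ (D₀ g)) D₁ b 1)
    - (fold g D₁ (suc (suc b)) 1 - fold (D₀ g) D₁ (suc b) 1)
    ≡⟨ cong₂ (λ p q → (p - fold (D₀ (D₀ g)) D₁ b 1) - (q - p))
             (cong-app (sym (fold-sucʳ (D₀ g) D₁ b)) 1)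
             (cong-app (sym (trans (fold-sucʳ (D₁ g) D₁ b) (fold-sucʳ g D₁ (suc b)))) 1) ⟩
  (fold (D₁ (D₀ g)) D₁ b 1 - fold (D₀ (D₀ g)) D₁ b 1)
    - (fold (D₁ (D₁ g)) D₁ b 1 - fold (D₁ (D₀ g)) D₁ b 1)
    ≡⟨ cong₂ _-_ (fold-D₁-difference b _ _ p (λ _ → refl) 1)
                 (fold-D₁-difference b _ _ r (λ _ → refl) 1) ⟩
  fold p D₁ b 1 - fold r D₁ b 1
    ≡⟨ fold-D₁-difference b p r (D₀ g) ([D₁-D₀]D₀-D₁[D₁-D₀]≡D₀ g) 1 ⟩
  fold (D₀ g) D₁ b 1 ∎
  where
  g p r : Fn
  g = fold idℤ D₀ a
  p x = D₁ (D₀ g) x - D₀ (D₀ g) x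
  r x = D₁ (D₁ g) x - D₁ (D₀ g) x

-- At x = 1 the weights of D₀ and D₁ are 1 and 2.
evenEntry-boundary : ∀ a → secondDifference (evenEntry a 1) (evenEntry (suc a) 0) (+ 0) ≡ + 0
evenEntry-boundary a = ring (fold idℤ D₀ a 1) (fold idℤ D₀ a 2)
  where
  ring : ∀ u v →
    ((+ 1 * + 1) * (v - u) - + 0) - ((+ 1 * + 2) * (v - u) - (+ 1 * + 1) * (v - u)) ≡ + 0
  ring = solve-∀

evenColumn : ℕ → ℕ → ℤ
evenColumn k zero = + 0
evenColumn k (suc a) = if a ≤ᵇ k then evenEntry a (k ∸ a) else + 0

oddColumn : ℕ → ℕ → ℤ
oddColumn k zero = + 0
oddColumn k (suc a) = evenColumn (suc k) (suc a) - evenColumn (suc k) (suc (suc a))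

evenColumn-entry : ∀ k a b → k ≡ a ℕ.+ b → evenColumn k (suc a) ≡ evenEntry a b
evenColumn-entry .(a ℕ.+ b) a b refl
  rewrite ≤ᵇ-true (ℕₚ.m≤m+n a b) | ℕₚ.m+n∸m≡n a b = refl

evenColumn-vanishes : ∀ k a → k < a → evenColumn k (suc a) ≡ + 0
evenColumn-vanishes k a k<a rewrite ≤ᵇ-false k<a = refl

evenColumn≡oddColumn-increment-first : ∀ k → evenColumn k 1 ≡ oddColumn k 1 - oddColumn k 0
evenColumn≡oddColumn-increment-first k = begin
  fold idℤ D₁ k 1                                  ≡⟨ fold-D₁-difference k _ _ _ D₁idℤ-D₀idℤ≡idℤ 1 ⟨
  fold (D₁ idℤ) D₁ k 1 - fold (D₀ idℤ) D₁ k 1      ≡⟨ cong (_- evenEntry 1 k) (cong-app (fold-sucʳ idℤ D₁ k) 1) ⟩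
  evenEntry 0 (suc k) - evenEntry 1 k               ≡⟨ ℤₚ.+-identityʳ _ ⟨
  (evenEntry 0 (suc k) - evenEntry 1 k) - + 0       ∎

evenColumn≡oddColumn-increment-interior : ∀ a b → let k = suc (a ℕ.+ b) in
  evenColumn k (suc (suc a)) ≡ oddColumn k (suc (suc a)) - oddColumn k (suc a)
evenColumn≡oddColumn-increment-interior a b = begin
  evenColumn (suc (a ℕ.+ b)) (suc (suc a))  ≡⟨ evenColumn-entry _ (suc a) b refl ⟩
  evenEntry (suc a) b                       ≡⟨ evenEntry-recurrence a b ⟨
  secondDifference (evenEntry a (suc (suc b))) (evenEntry (suc a) (suc b)) (evenEntry (suc (suc a)) b)
    ≡⟨ secondDifference-cong (evenColumn-entry _ a (suc (suc b)) a+2+b)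
                             (evenColumn-entry _ (suc a) (suc b) (cong suc (sym (ℕₚ.+-suc a b))))
                             (evenColumn-entry _ (suc (suc a)) b refl) ⟨
  oddColumn (suc (a ℕ.+ b)) (suc (suc a)) - oddColumn (suc (a ℕ.+ b)) (suc a) ∎
  where
  a+2+b : suc (suc (a ℕ.+ b)) ≡ a ℕ.+ suc (suc b)
  a+2+b = sym (trans (ℕₚ.+-suc a (suc b)) (cong suc (ℕₚ.+-suc a b)))

evenColumn≡oddColumn-increment-last : ∀ k →
  evenColumn k (suc (suc k)) ≡ oddColumn k (suc (suc k)) - oddColumn k (suc k)
evenColumn≡oddColumn-increment-last k = begin
  evenColumn k (suc (suc k))                          ≡⟨ evenColumn-vanishes k (suc k) (ℕₚ.n<1+n k) ⟩
  + 0                                                 ≡⟨ evenEntry-boundary k ⟨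
  secondDifference (evenEntry k 1) (evenEntry (suc k) 0) (+ 0)
    ≡⟨ secondDifference-cong (evenColumn-entry (suc k) k 1 (ℕₚ.+-comm 1 k))
                             (evenColumn-entry (suc k) (suc k) 0 (sym (ℕₚ.+-identityʳ (suc k))))
                             (evenColumn-vanishes (suc k) (suc (suc k)) (ℕₚ.n<1+n (suc k))) ⟨
  oddColumn k (suc (suc k)) - oddColumn k (suc k)     ∎

evenColumn≡oddColumn-increment : ∀ k a → a ≤ suc k →
  evenColumn k (suc a) ≡ oddColumn k (suc a) - oddColumn k a
evenColumn≡oddColumn-increment k zero _ = evenColumn≡oddColumn-increment-first k
evenColumn≡oddColumn-increment k (suc a) a≤1+k with ℕₚ.m≤n⇒m<n∨m≡n a≤1+k
... | inj₁ (s≤s a<k) =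
  subst (λ k → evenColumn k (suc (suc a)) ≡ oddColumn k (suc (suc a)) - oddColumn k (suc a))
        (ℕₚ.m+[n∸m]≡n a<k) (evenColumn≡oddColumn-increment-interior a (k ∸ suc a))
... | inj₂ refl = evenColumn≡oddColumn-increment-last k

-- The columns of the Seidel triangle

sumFromTo-empty : ∀ (c : ℕ → ℕ) m b → b < m → sumFromTo m b c ≡ 0
sumFromTo-empty c (suc m) zero _ = refl
sumFromTo-empty c m (suc b) b<m rewrite ≤ᵇ-false b<m =
  sumFromTo-empty c m b (ℕₚ.<-trans (ℕₚ.n<1+n b) b<m)

sumFromTo-prefix-telescope : ∀ (c : ℕ → ℕ) (o : ℕ → ℤ) q →
  (∀ p → 1 ≤ p → p ≤ q → + c p ≡ o p - o (p ∸ 1)) →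
  + sumFromTo 1 q c ≡ o q - o 0
sumFromTo-prefix-telescope c o zero _ = sym (ℤₚ.+-inverseʳ (o 0))
sumFromTo-prefix-telescope c o (suc q) c≡Δo = begin
  + c (suc q) + + sumFromTo 1 q c
    ≡⟨ cong₂ _+_ (c≡Δo (suc q) (s≤s z≤n) ℕₚ.≤-refl)
                 (sumFromTo-prefix-telescope c o q (λ p 1≤p p≤q → c≡Δo p 1≤p (ℕₚ.m≤n⇒m≤1+n p≤q))) ⟩
  (o (suc q) - o q) + (o q - o 0)
    ≡⟨ telescope (o (suc q)) (o q) (o 0) ⟩
  o (suc q) - o 0 ∎
  where
  telescope : ∀ u v w → (u - v) + (v - w) ≡ u - w
  telescope = solve-∀

sumFromTo-suffix-telescope : ∀ (c : ℕ → ℕ) (o : ℕ → ℤ) m b → m ≤ b →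
  (∀ q → m ≤ q → q ≤ b → + c q ≡ o q - o (suc q)) →
  + sumFromTo m b c ≡ o m - o (suc b)
sumFromTo-suffix-telescope c o zero zero _ c≡∇o = c≡∇o 0 z≤n z≤n
sumFromTo-suffix-telescope c o m (suc b) m≤1+b c≡∇o
  rewrite ≤ᵇ-true m≤1+b with ℕₚ.m≤n⇒m<n∨m≡n m≤1+b
... | inj₁ (s≤s m≤b) = begin
  + c (suc b) + + sumFromTo m b c
    ≡⟨ cong₂ _+_ (c≡∇o (suc b) m≤1+b ℕₚ.≤-refl)
                 (sumFromTo-suffix-telescope c o m b m≤b (λ q m≤q q≤b → c≡∇o q m≤q (ℕₚ.m≤n⇒m≤1+n q≤b))) ⟩
  (o (suc b) - o (suc (suc b))) + (o m - o (suc b))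
    ≡⟨ telescope (o m) (o (suc b)) (o (suc (suc b))) ⟩
  o m - o (suc (suc b)) ∎
  where
  telescope : ∀ u v w → (v - w) + (u - v) ≡ u - w
  telescope = solve-∀
... | inj₂ refl rewrite sumFromTo-empty c (suc b) b (ℕₚ.n<1+n b) =
  trans (ℤₚ.+-identityʳ _) (c≡∇o (suc b) ℕₚ.≤-refl ℕₚ.≤-refl)

twice : ℕ → ℕ
twice zero = 0
twice (suc k) = suc (suc (twice k))

twice≡2* : ∀ k → twice k ≡ 2 ℕ.* k
twice≡2* zero = refl
twice≡2* (suc k) = trans (cong (λ n → suc (suc n)) (twice≡2* k)) (sym (ℕₚ.*-suc 2 k))

n≤twice[n] : ∀ n → n ≤ twice n
n≤twice[n] zero = z≤n
n≤twice[n] (suc n) = s≤s (ℕₚ.m≤n⇒m≤1+n (n≤twice[n] n))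

[r+twice[k]]/2≡r/2+k : ∀ r k → (r ℕ.+ twice k) / 2 ≡ r / 2 ℕ.+ k
[r+twice[k]]/2≡r/2+k r zero = trans (cong (_/ 2) (ℕₚ.+-identityʳ r)) (sym (ℕₚ.+-identityʳ (r / 2)))
[r+twice[k]]/2≡r/2+k r (suc k) = begin
  (r ℕ.+ suc (suc (twice k))) / 2  ≡⟨ cong (_/ 2) (trans (ℕₚ.+-suc r _) (cong suc (ℕₚ.+-suc r _))) ⟩
  (suc (suc r) ℕ.+ twice k) / 2    ≡⟨ [r+twice[k]]/2≡r/2+k (suc (suc r)) k ⟩
  suc (suc r) / 2 ℕ.+ k            ≡⟨ cong (ℕ._+ k) (m/n≡1+[m∸n]/n {suc (suc r)} (s≤s (s≤s z≤n))) ⟩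
  suc (r / 2 ℕ.+ k)                ≡⟨ ℕₚ.+-suc (r / 2) k ⟨
  r / 2 ℕ.+ suc k                  ∎

isEven-twice : ∀ k → isEven (twice k) ≡ true
isEven-twice zero = refl
isEven-twice (suc k) = trans (not-involutive _) (isEven-twice k)

restrict-inside : ∀ j f n → 1 ≤ n → n ≤ suc j / 2 → restrict j f n ≡ f n
restrict-inside j f n 1≤n n≤bound rewrite ≤ᵇ-true 1≤n | ≤ᵇ-true n≤bound = refl

restrict-outside : ∀ j f n → suc j / 2 < n → restrict j f n ≡ 0
restrict-outside j f (suc n) bound<n rewrite ≤ᵇ-false bound<n = refl

columnStep : ℕ → ℕ → ℕ
columnStep j m = if isEven (suc (suc j))
  then sumFromTo m (suc (suc j)) (column (suc j))
  else sumFromTo 1 m (column (suc j))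

column-outside : ∀ j n → suc j / 2 < n → column j n ≡ 0
column-outside zero n _ = refl
column-outside (suc zero) n = restrict-outside 1 (λ _ → 1) n
column-outside (suc (suc j)) n = restrict-outside (suc (suc j)) (columnStep j) n

column-inside : ∀ j n → 1 ≤ n → n ≤ suc (suc (suc j)) / 2 →
  column (suc (suc j)) n
    ≡ (if isEven j then sumFromTo n (suc (suc j)) (column (suc j)) else sumFromTo 1 n (column (suc j)))
column-inside j n 1≤n n≤bound =
  trans (restrict-inside (suc (suc j)) (columnStep j) n 1≤n n≤bound)
        (cong (λ e → if e then sumFromTo n (suc (suc j)) (column (suc j)) else sumFromTo 1 n (column (suc j)))
              (not-involutive (isEven j)))

column-even-inside : ∀ k n → 1 ≤ n → n ≤ suc k →
  column (twice (suc k)) n ≡ sumFromTo n (twice (suc k)) (column (suc (twice k)))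
column-even-inside k n 1≤n n≤1+k =
  trans (column-inside (twice k) n 1≤n n≤bound)
        (cong (λ e → if e then sumFromTo n (twice (suc k)) (column (suc (twice k)))
                          else sumFromTo 1 n (column (suc (twice k))))
              (isEven-twice k))
  where
  n≤bound : n ≤ suc (suc (suc (twice k))) / 2
  n≤bound = subst (n ≤_) (sym ([r+twice[k]]/2≡r/2+k 3 k)) n≤1+k

column-odd-inside : ∀ k n → 1 ≤ n → n ≤ suc (suc k) →
  column (suc (twice (suc k))) n ≡ sumFromTo 1 n (column (twice (suc k)))
column-odd-inside k n 1≤n n≤2+k =
  trans (column-inside (suc (twice k)) n 1≤n n≤bound)
        (cong (λ e → if e then sumFromTo n (suc (twice (suc k))) (column (twice (suc k)))
                          else sumFromTo 1 n (column (twice (suc k))))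
              (cong not (isEven-twice k)))
  where
  n≤bound : n ≤ suc (suc (suc (suc (twice k)))) / 2
  n≤bound = subst (n ≤_) (sym ([r+twice[k]]/2≡r/2+k 4 k)) n≤2+k

column-odd : ∀ k → (∀ n → + column (twice (suc k)) n ≡ evenColumn k n) →
  ∀ n → + column (suc (twice (suc k))) n ≡ oddColumn k n
column-odd k even zero = refl
column-odd k even (suc a) with a ≤? suc k
... | yes a≤1+k = begin
  + column (suc (twice (suc k))) (suc a)
    ≡⟨ cong +_ (column-odd-inside k (suc a) (s≤s z≤n) (s≤s a≤1+k)) ⟩
  + sumFromTo 1 (suc a) (column (twice (suc k)))
    ≡⟨ sumFromTo-prefix-telescope _ (oddColumn k) (suc a) column≡Δodd ⟩
  oddColumn k (suc a) - + 0
    ≡⟨ ℤₚ.+-identityʳ _ ⟩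
  oddColumn k (suc a) ∎
  where
  column≡Δodd : ∀ p → 1 ≤ p → p ≤ suc a →
    + column (twice (suc k)) p ≡ oddColumn k p - oddColumn k (p ∸ 1)
  column≡Δodd (suc p) _ p<1+a =
    trans (even (suc p)) (evenColumn≡oddColumn-increment k p (ℕₚ.≤-trans (ℕₚ.≤-pred p<1+a) a≤1+k))
... | no a≰1+k = begin
  + column (suc (twice (suc k))) (suc a)
    ≡⟨ cong +_ (column-outside (suc (twice (suc k))) (suc a) (subst (_< suc a) (sym ([r+twice[k]]/2≡r/2+k 4 k)) (s≤s 1+k<a))) ⟩
  + 0
    ≡⟨ cong₂ _-_ (evenColumn-vanishes (suc k) a 1+k<a)
                 (evenColumn-vanishes (suc k) (suc a) (ℕₚ.m<n⇒m<1+n 1+k<a)) ⟨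
  oddColumn k (suc a) ∎
  where
  1+k<a : suc k < a
  1+k<a = ℕₚ.≰⇒> a≰1+k

column-even : ∀ k n → + column (twice (suc k)) n ≡ evenColumn k n
column-even zero zero = refl
column-even zero (suc zero) = refl
column-even zero (suc (suc n)) = refl
column-even (suc k) zero = refl
column-even (suc k) (suc a) with a ≤? suc k
... | yes a≤1+k = begin
  + column (twice (suc (suc k))) (suc a)
    ≡⟨ cong +_ (column-even-inside (suc k) (suc a) (s≤s z≤n) (s≤s a≤1+k)) ⟩
  + sumFromTo (suc a) B (column (suc (twice (suc k))))
    ≡⟨ sumFromTo-suffix-telescope _ (evenColumn (suc k)) (suc a) B 1+a≤B
         (λ { (suc q) _ _ → column-odd k (column-even k) (suc q) }) ⟩
  evenColumn (suc k) (suc a) - evenColumn (suc k) (suc B)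
    ≡⟨ cong (λ t → evenColumn (suc k) (suc a) - t) (evenColumn-vanishes (suc k) B 1+k<B) ⟩
  evenColumn (suc k) (suc a) - + 0
    ≡⟨ ℤₚ.+-identityʳ _ ⟩
  evenColumn (suc k) (suc a) ∎
  where
  B : ℕ
  B = twice (suc (suc k))
  1+k<B : suc k < B
  1+k<B = s≤s (s≤s (ℕₚ.m≤n⇒m≤1+n (ℕₚ.m≤n⇒m≤1+n (n≤twice[n] k))))
  1+a≤B : suc a ≤ B
  1+a≤B = ℕₚ.≤-trans (s≤s a≤1+k) 1+k<B
... | no a≰1+k = begin
  + column (twice (suc (suc k))) (suc a)
    ≡⟨ cong +_ (column-outside (twice (suc (suc k))) (suc a) (subst (_< suc a) (sym ([r+twice[k]]/2≡r/2+k 3 (suc k))) (s≤s 1+k<a))) ⟩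
  + 0
    ≡⟨ evenColumn-vanishes (suc k) a 1+k<a ⟨
  evenColumn (suc k) (suc a) ∎
  where
  1+k<a : suc k < a
  1+k<a = ℕₚ.≰⇒> a≰1+k

medianGenocchi≡fold-D₁ : ∀ k → + medianGenocchi (suc k) ≡ fold idℤ D₁ k 1
medianGenocchi≡fold-D₁ k = begin
  + column (2 ℕ.* suc k) 1      ≡⟨ cong (λ j → + column j 1) (twice≡2* (suc k)) ⟨
  + column (twice (suc k)) 1    ≡⟨ column-even k 1 ⟩
  fold idℤ D₁ k 1               ∎

-- Legendre–Stirling sums

sumℤ-cong : ∀ n (f g : Fn) → (∀ j → f j ≡ g j) → sumℤ 0 n f ≡ sumℤ 0 n g
sumℤ-cong zero f g f≡g = f≡g 0
sumℤ-cong (suc n) f g f≡g = cong₂ _+_ (f≡g (suc n)) (sumℤ-cong n f g f≡g)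

sumℤ-+ : ∀ n (f g : Fn) → sumℤ 0 n (λ j → f j + g j) ≡ sumℤ 0 n f + sumℤ 0 n g
sumℤ-+ zero f g = refl
sumℤ-+ (suc n) f g = begin
  (f (suc n) + g (suc n)) + sumℤ 0 n (λ j → f j + g j)
    ≡⟨ cong (_+_ (f (suc n) + g (suc n))) (sumℤ-+ n f g) ⟩
  (f (suc n) + g (suc n)) + (sumℤ 0 n f + sumℤ 0 n g)
    ≡⟨ +-interchange (f (suc n)) (g (suc n)) (sumℤ 0 n f) (sumℤ 0 n g) ⟩
  (f (suc n) + sumℤ 0 n f) + (g (suc n) + sumℤ 0 n g) ∎

sumℤ-shift : ∀ n (f : Fn) → sumℤ 0 (suc n) f ≡ sumℤ 0 n (λ j → f (suc j)) + f 0
sumℤ-shift zero f = refl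
sumℤ-shift (suc n) f =
  trans (cong (_+_ (f (suc (suc n)))) (sumℤ-shift n f))
        (sym (ℤₚ.+-assoc (f (suc (suc n))) (sumℤ 0 n (λ j → f (suc j))) (f 0)))

sumℤ-shift-vanishing : ∀ n (f : Fn) → f 0 ≡ + 0 → f (suc n) ≡ + 0 →
  sumℤ 0 n (λ j → f (suc j)) ≡ sumℤ 0 n f
sumℤ-shift-vanishing n f f0≡0 f[1+n]≡0 = begin
  sumℤ 0 n (λ j → f (suc j))          ≡⟨ ℤₚ.+-identityʳ _ ⟨
  sumℤ 0 n (λ j → f (suc j)) + + 0    ≡⟨ cong (_+_ (sumℤ 0 n (λ j → f (suc j)))) f0≡0 ⟨
  sumℤ 0 n (λ j → f (suc j)) + f 0    ≡⟨ sumℤ-shift n f ⟨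
  f (suc n) + sumℤ 0 n f              ≡⟨ cong (_+ sumℤ 0 n f) f[1+n]≡0 ⟩
  + 0 + sumℤ 0 n f                    ≡⟨ ℤₚ.+-identityˡ _ ⟩
  sumℤ 0 n f                          ∎

sumℤ-from-2 : ∀ n (f : Fn) → f 0 ≡ + 0 → f 1 ≡ + 0 → sumℤ 2 n f ≡ sumℤ 0 n f
sumℤ-from-2 zero f f0≡0 _ = sym f0≡0
sumℤ-from-2 (suc zero) f f0≡0 f1≡0 = cong₂ _+_ (sym f1≡0) (sym f0≡0)
sumℤ-from-2 (suc (suc n)) f f0≡0 f1≡0 = cong (_+_ (f (suc (suc n)))) (sumℤ-from-2 (suc n) f f0≡0 f1≡0)

n<j⇒LS[n,j]≡0 : ∀ n j → n < j → LS n j ≡ 0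
n<j⇒LS[n,j]≡0 zero (suc j) _ = refl
n<j⇒LS[n,j]≡0 (suc n) (suc j) (s≤s n<j)
  rewrite n<j⇒LS[n,j]≡0 n j n<j | n<j⇒LS[n,j]≡0 n (suc j) (ℕₚ.m<n⇒m<1+n n<j) =
  ℕₚ.*-zeroʳ (suc j ℕ.* suc (suc j))

+LS-suc : ∀ n j → + LS (suc n) (suc j) ≡ + LS n j + (+ suc j * + suc (suc j)) * + LS n (suc j)
+LS-suc n j = cong (_+_ (+ LS n j))
  (trans (ℤₚ.pos-* (suc j ℕ.* suc (suc j)) (LS n (suc j)))
         (cong (_* + LS n (suc j)) (ℤₚ.pos-* (suc j) (suc (suc j)))))

Λ : Fn → Fn
Λ ψ j = ψ (suc j) + (+ j * + suc j) * ψ j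

LS-sum : ∀ n ψ → sumℤ 0 n (λ j → + LS n j * ψ j) ≡ fold ψ Λ n 0
LS-sum zero ψ = ℤₚ.*-identityˡ (ψ 0)
LS-sum (suc n) ψ = begin
  sumℤ 0 (suc n) (λ j → + LS (suc n) j * ψ j)
    ≡⟨ trans (sumℤ-shift n (λ j → + LS (suc n) j * ψ j)) (ℤₚ.+-identityʳ _) ⟩
  sumℤ 0 n (λ j → + LS (suc n) (suc j) * ψ (suc j))
    ≡⟨ sumℤ-cong n _ _ (λ j → trans (cong (_* ψ (suc j)) (+LS-suc n j))
                                    (split (+ LS n j) (+ suc j * + suc (suc j)) (+ LS n (suc j)) (ψ (suc j)))) ⟩
  sumℤ 0 n (λ j → + LS n j * ψ (suc j) + h (suc j))
    ≡⟨ sumℤ-+ n _ _ ⟩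
  sumℤ 0 n (λ j → + LS n j * ψ (suc j)) + sumℤ 0 n (λ j → h (suc j))
    ≡⟨ cong (_+_ (sumℤ 0 n (λ j → + LS n j * ψ (suc j)))) (sumℤ-shift-vanishing n h refl h[1+n]≡0) ⟩
  sumℤ 0 n (λ j → + LS n j * ψ (suc j)) + sumℤ 0 n h
    ≡⟨ sumℤ-+ n _ _ ⟨
  sumℤ 0 n (λ j → + LS n j * ψ (suc j) + h j)
    ≡⟨ sumℤ-cong n _ _ (λ j → merge (+ LS n j) (ψ (suc j)) (+ j * + suc j) (ψ j)) ⟩
  sumℤ 0 n (λ j → + LS n j * Λ ψ j)
    ≡⟨ LS-sum n (Λ ψ) ⟩
  fold (Λ ψ) Λ n 0
    ≡⟨ cong-app (fold-sucʳ ψ Λ n) 0 ⟩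
  fold ψ Λ (suc n) 0 ∎
  where
  h : Fn
  h j = (+ j * + suc j) * (+ LS n j * ψ j)
  h[1+n]≡0 : h (suc n) ≡ + 0
  h[1+n]≡0 rewrite n<j⇒LS[n,j]≡0 n (suc n) ℕₚ.≤-refl = ℤₚ.*-zeroʳ (+ suc n * + suc (suc n))
  split : ∀ l c l′ y → (l + c * l′) * y ≡ l * y + c * (l′ * y)
  split = solve-∀
  merge : ∀ l y′ c y → l * y′ + c * (l * y) ≡ l * (y′ + c * y)
  merge = solve-∀

-- Stirling numbers of the first kind

sgn[n+2]≡sgn[n] : ∀ n → sgn (n ℕ.+ 2) ≡ sgn n
sgn[n+2]≡sgn[n] zero = refl
sgn[n+2]≡sgn[n] (suc n) = cong -_ (sgn[n+2]≡sgn[n] n)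

sgn[2+n]*[sgn[n]*x]≡x : ∀ n x → sgn (suc (suc n)) * (sgn n * x) ≡ x
sgn[2+n]*[sgn[n]*x]≡x zero x = trans (ℤₚ.*-identityˡ _) (ℤₚ.*-identityˡ x)
sgn[2+n]*[sgn[n]*x]≡x (suc n) x = trans (flip (sgn n) x) (sgn[2+n]*[sgn[n]*x]≡x n x)
  where
  flip : ∀ s x → (- (- (- s))) * ((- s) * x) ≡ (- (- s)) * (s * x)
  flip = solve-∀

stirling1u[1+n,1]≡n! : ∀ n → stirling1u (suc n) 1 ≡ n !
stirling1u[1+n,1]≡n! zero = refl
stirling1u[1+n,1]≡n! (suc n) = cong (suc n ℕ.*_) (stirling1u[1+n,1]≡n! n)

weight : ℕ → ℤ
weight j = sgn (suc j) * (+ (j !) * + (ℕ.pred j !))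

weight-suc : ∀ i → weight (suc (suc i)) ≡ - (+ suc i * + suc (suc i)) * weight (suc i)
weight-suc i = begin
  (- sgn (suc (suc i))) * (+ (suc (suc i) ℕ.* suc i !) * + (suc i !))
    ≡⟨ cong₂ (λ p q → (- sgn (suc (suc i))) * (p * q)) (ℤₚ.pos-* (suc (suc i)) (suc i !)) (ℤₚ.pos-* (suc i) (i !)) ⟩
  (- sgn (suc (suc i))) * ((+ suc (suc i) * + (suc i !)) * (+ suc i * + (i !)))
    ≡⟨ ring (sgn (suc (suc i))) (+ suc i) (+ suc (suc i)) (+ (suc i !)) (+ (i !)) ⟩
  - (+ suc i * + suc (suc i)) * weight (suc i) ∎
  where
  ring : ∀ s X Y G F → (- s) * ((Y * G) * (X * F)) ≡ - (X * Y) * (s * (G * F))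
  ring = solve-∀

Λ-factorialStirling : ∀ i → Λ (λ j → + (j !) * stirling1 j 2) (suc i) ≡ weight (suc i) * + suc (suc i)
Λ-factorialStirling i = begin
  + (suc (suc i) !) * stirling1 (suc (suc i)) 2 + (+ suc i * + suc (suc i)) * (+ (suc i !) * stirling1 (suc i) 2)
    ≡⟨ cong₂ (λ p q → p + (+ suc i * + suc (suc i)) * q) f[2+i] f[1+i] ⟩
  ((+ 1 + (+ 1 + X)) * ((+ 1 + X) * F)) * ((- (- s)) * (F + (+ 1 + X) * C))
    + (+ suc i * + suc (suc i)) * (((+ 1 + X) * F) * ((- s) * C))
    ≡⟨ ring X F s C ⟩
  ((- (- s)) * (((+ 1 + X) * F) * F)) * (+ 1 + (+ 1 + X))
    ≡⟨ cong (λ G → ((- (- s)) * (G * F)) * + suc (suc i)) (ℤₚ.pos-* (suc i) (i !)) ⟨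
  weight (suc i) * + suc (suc i) ∎
  where
  X F s C : ℤ
  X = + i
  F = + (i !)
  s = sgn i
  C = + stirling1u (suc i) 2
  f[2+i] : + (suc (suc i) !) * stirling1 (suc (suc i)) 2
         ≡ ((+ 1 + (+ 1 + X)) * ((+ 1 + X) * F)) * ((- (- s)) * (F + (+ 1 + X) * C))
  f[2+i] = cong₂ _*_
    (trans (ℤₚ.pos-* (suc (suc i)) (suc i !)) (cong (+ suc (suc i) *_) (ℤₚ.pos-* (suc i) (i !))))
    (cong₂ _*_ (cong (λ t → - (- t)) (sgn[n+2]≡sgn[n] i))
               (cong₂ _+_ (cong +_ (stirling1u[1+n,1]≡n! i)) (ℤₚ.pos-* (suc i) _)))
  f[1+i] : + (suc i !) * stirling1 (suc i) 2 ≡ ((+ 1 + X) * F) * ((- s) * C)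
  f[1+i] = cong₂ _*_ (ℤₚ.pos-* (suc i) (i !)) (cong (λ t → (- t) * C) (sgn[n+2]≡sgn[n] i))
  ring : ∀ X F s C →
    ((+ 1 + (+ 1 + X)) * ((+ 1 + X) * F)) * ((- (- s)) * (F + (+ 1 + X) * C))
      + ((+ 1 + X) * (+ 1 + (+ 1 + X))) * (((+ 1 + X) * F) * ((- s) * C))
    ≡ ((- (- s)) * (((+ 1 + X) * F) * F)) * (+ 1 + (+ 1 + X))
  ring = solve-∀

fold-Λ-weight : ∀ m (ψ φ : Fn) → (∀ i → ψ (suc i) ≡ weight (suc i) * φ (suc i)) →
  ∀ i → fold ψ Λ m (suc i) ≡ weight (suc i) * (sgn m * fold φ D₁ m (suc i))
fold-Λ-weight zero ψ φ ψ≡wφ i = trans (ψ≡wφ i) (cong (weight (suc i) *_) (sym (ℤₚ.*-identityˡ (φ (suc i)))))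
fold-Λ-weight (suc m) ψ φ ψ≡wφ i = begin
  fold ψ Λ m (suc (suc i)) + (X * Y) * fold ψ Λ m (suc i)
    ≡⟨ cong₂ (λ p q → p + (X * Y) * q) (fold-Λ-weight m ψ φ ψ≡wφ (suc i)) (fold-Λ-weight m ψ φ ψ≡wφ i) ⟩
  weight (suc (suc i)) * (sgn m * A) + (X * Y) * (weight (suc i) * (sgn m * B))
    ≡⟨ cong (λ w → w * (sgn m * A) + (X * Y) * (weight (suc i) * (sgn m * B))) (weight-suc i) ⟩
  (- (X * Y) * weight (suc i)) * (sgn m * A) + (X * Y) * (weight (suc i) * (sgn m * B))
    ≡⟨ ring (weight (suc i)) (sgn m) X Y A B ⟩
  weight (suc i) * ((- sgn m) * ((X * Y) * (A - B))) ∎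
  where
  X Y A B : ℤ
  X = + suc i
  Y = + suc (suc i)
  A = fold φ D₁ m (suc (suc i))
  B = fold φ D₁ m (suc i)
  ring : ∀ w s X Y A B →
    (- (X * Y) * w) * (s * A) + (X * Y) * (w * (s * B)) ≡ w * ((- s) * ((X * Y) * (A - B)))
  ring = solve-∀

LS-factorialStirling-sum : ∀ k →
  sumℤ 2 (suc (suc k)) (λ j → + LS (suc (suc k)) j * + (j !) * stirling1 j 2)
  ≡ sgn k * fold (λ y → + suc y) D₁ k 1
LS-factorialStirling-sum k = begin
  sumℤ 2 n (λ j → + LS n j * + (j !) * stirling1 j 2)
    ≡⟨ sumℤ-from-2 n (λ j → + LS n j * + (j !) * stirling1 j 2) refl (ℤₚ.*-zeroʳ (+ LS n 1 * + 1)) ⟩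
  sumℤ 0 n (λ j → + LS n j * + (j !) * stirling1 j 2)
    ≡⟨ sumℤ-cong n _ _ (λ j → ℤₚ.*-assoc (+ LS n j) (+ (j !)) (stirling1 j 2)) ⟩
  sumℤ 0 n (λ j → + LS n j * f j)
    ≡⟨ LS-sum n f ⟩
  fold f Λ (suc k) 1 + + 0
    ≡⟨ ℤₚ.+-identityʳ _ ⟩
  fold f Λ (suc k) 1
    ≡⟨ cong-app (fold-sucʳ f Λ k) 1 ⟨
  fold (Λ f) Λ k 1
    ≡⟨ fold-Λ-weight k (Λ f) (λ y → + suc y) Λ-factorialStirling 0 ⟩
  + 1 * (sgn k * fold (λ y → + suc y) D₁ k 1)
    ≡⟨ ℤₚ.*-identityˡ _ ⟩
  sgn k * fold (λ y → + suc y) D₁ k 1 ∎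
  where
  n : ℕ
  n = suc (suc k)
  f : Fn
  f j = + (j !) * stirling1 j 2

fold-D₁-shift : ∀ k → fold (λ y → + suc y) D₁ k 1 - δ (suc (suc k)) 2 ≡ fold idℤ D₁ k 1
fold-D₁-shift zero = refl
fold-D₁-shift (suc k) = begin
  fold (λ y → + suc y) D₁ (suc k) 1 - + 0   ≡⟨ ℤₚ.+-identityʳ _ ⟩
  fold (λ y → + suc y) D₁ (suc k) 1         ≡⟨ cong-app (fold-sucʳ (λ y → + suc y) D₁ k) 1 ⟨
  fold (D₁ (λ y → + suc y)) D₁ k 1          ≡⟨ fold-D₁-cong k _ _ (λ x → cong (+ x * + suc x *_) (Δ[1+y]≡Δy (+ x))) 1 ⟩
  fold (D₁ idℤ) D₁ k 1                      ≡⟨ cong-app (fold-sucʳ idℤ D₁ k) 1 ⟩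
  fold idℤ D₁ (suc k) 1                     ∎
  where
  Δ[1+y]≡Δy : ∀ Y → (+ 1 + (+ 1 + Y)) - (+ 1 + Y) ≡ (+ 1 + Y) - Y
  Δ[1+y]≡Δy = solve-∀

proposition6 : (n : ℕ) → 2 ≤ n →
    + medianGenocchi (n ∸ 1) ≡
      sgn n * sumℤ 2 n (λ j → + LS n j * + (j !) * stirling1 j 2) - δ n 2
proposition6 (suc zero) (s≤s ())
proposition6 (suc (suc k)) _ = begin
  + medianGenocchi (suc k)
    ≡⟨ medianGenocchi≡fold-D₁ k ⟩
  fold idℤ D₁ k 1
    ≡⟨ fold-D₁-shift k ⟨
  fold (λ y → + suc y) D₁ k 1 - δ n 2
    ≡⟨ cong (_- δ n 2) (sgn[2+n]*[sgn[n]*x]≡x k _) ⟨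
  sgn n * (sgn k * fold (λ y → + suc y) D₁ k 1) - δ n 2
    ≡⟨ cong (λ t → sgn n * t - δ n 2) (LS-factorialStirling-sum k) ⟨
  sgn n * sumℤ 2 n (λ j → + LS n j * + (j !) * stirling1 j 2) - δ n 2 ∎
  where
  n : ℕ
  n = suc (suc k)
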